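{- Let $K$ be a positive commutative semiring, $A$ a finite non-empty set and $\pi:\mathsf{Lit}_A\to K$ a $K$-interpretation such that for every $L\in\mathsf{Lit}_A$ we have $\pi(L)\neq0$ or $\pi(\neg L)\neq0$ (equivalently $\pi(L)+\pi(\neg L)\neq0$). Then for every first-order sentence $\phi$ we have $\pi[\![\phi]\!]\neq0$ or $\pi[\![\neg\phi]\!]\neq0$ (equivalently $\pi[\![\phi]\!]+\pi[\![\neg\phi]\!]\neq0$).
   Context: A commutative semiring $(K,+,\cdot,0,1)$ has $0\neq1$, commutative monoids $(K,+,0)$, $(K,\cdot,1)$, distributivity and $0\cdot a=0$; it is positive if $a+b=0$ implies $a=b=0$ and there are no $a,b\neq0$ with $ab=0$. For a finite relational vocabulary $\mathscr V$ and finite non-empty $A$, $\mathsf{Lit}_A$ is the set of ground atoms $R(\mathbf a)$ and their negations, with $\neg\neg R(\mathbf a)$ identified with $R(\mathbf a)$. $\mathsf{nnf}$ is the standard negation normal form (built from literals and $x=y$, $x\ne y$ with $\wedge,\vee,\exists,\forall$). A $K$-interpretation $\pi:\mathsf{Lit}_A\to K$ is extended to formulas under valuations $\nu$ into $A$: literals are evaluated by $\pi$ at their ground instances, $x=y$/$x\neq y$ get $1$ if true and $0$ otherwise, $\wedge\mapsto\cdot$, $\vee\mapsto+$, $\exists x\mapsto\sum_{a\in A}$, $\forall x\mapsto\prod_{a\in A}$ (over $\nu[x\mapsto a]$), and $\pi[\![\neg\phi]\!]_\nu=\pi[\![\mathsf{nnf}(\neg\phi)]\!]_\nu$; for sentences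 write $\pi[\![\phi]\!]$. -}

module Defs where

open import Level using (Level)
open import Data.Nat using (ℕ; zero; suc)
open import Data.Fin using (Fin; zero; suc; _≟_)
open import Data.Vec using (Vec; map)
open import Data.Bool using (Bool; true; false; not)
open import Data.Product using (_×_)
open import Relation.Nullary using (¬_; yes; no)
open import Algebra.Bundles using (CommutativeSemiring)

record Vocabulary : Set where
  field
    nRel  : ℕ
    arity : Fin nRel → ℕ
open Vocabulary public

-- Positive commutative semiring (stdlib CommutativeSemiring already has
-- the monoid laws, distributivity and 0·a = 0; we add 0 ≠ 1 and positivity).
record IsPositive {c ℓ} (K : CommutativeSemiring c ℓ) : Set (c Level.⊔ ℓ) where
  open CommutativeSemiring K
  field
    zero≉one      : ¬ (0# ≈ 1#)
    plus-positive : ∀ a b → a + b ≈ 0# → (a ≈ 0#) × (b ≈ 0#)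
    no-zero-div   : ∀ a b → ¬ (a ≈ 0#) → ¬ (b ≈ 0#) → ¬ (a * b ≈ 0#)

module _ (V : Vocabulary) where

  -- First-order formulas over V with k free variables (de Bruijn indices).
  data Formula : ℕ → Set where
    rel  : ∀ {k} (R : Fin (nRel V)) → Vec (Fin k) (arity V R) → Formula k
    eq   : ∀ {k} → Fin k → Fin k → Formula k
    ¬'_  : ∀ {k} → Formula k → Formula k
    _∧'_ : ∀ {k} → Formula k → Formula k → Formula k
    _∨'_ : ∀ {k} → Formula k → Formula k → Formula k
    ∃'   : ∀ {k} → Formula (suc k) → Formula k
    ∀'   : ∀ {k} → Formula (suc k) → Formula k

  Sentence : Set
  Sentence = Formula 0

  -- Negation normal form formulas: literals (with polarity, true = positive),
  -- x = y, x ≠ y, ∧, ∨, ∃, ∀.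
  data NNF : ℕ → Set where
    lit  : ∀ {k} → Bool → (R : Fin (nRel V)) → Vec (Fin k) (arity V R) → NNF k
    eq   : ∀ {k} → Fin k → Fin k → NNF k
    neq  : ∀ {k} → Fin k → Fin k → NNF k
    and  : ∀ {k} → NNF k → NNF k → NNF k
    or   : ∀ {k} → NNF k → NNF k → NNF k
    ex   : ∀ {k} → NNF (suc k) → NNF k
    all  : ∀ {k} → NNF (suc k) → NNF k

  nnf    : ∀ {k} → Formula k → NNF k
  nnfNeg : ∀ {k} → Formula k → NNF k
  nnf (rel R xs) = lit true R xs
  nnf (eq x y)   = eq x y
  nnf (¬' φ)     = nnfNeg φ
  nnf (φ ∧' ψ)   = and (nnf φ) (nnf ψ)
  nnf (φ ∨' ψ)   = or (nnf φ) (nnf ψ)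
  nnf (∃' φ)     = ex (nnf φ)
  nnf (∀' φ)     = all (nnf φ)
  nnfNeg (rel R xs) = lit false R xs
  nnfNeg (eq x y)   = neq x y
  nnfNeg (¬' φ)     = nnf φ
  nnfNeg (φ ∧' ψ)   = or (nnfNeg φ) (nnfNeg ψ)
  nnfNeg (φ ∨' ψ)   = and (nnfNeg φ) (nnfNeg ψ)
  nnfNeg (∃' φ)     = all (nnfNeg φ)
  nnfNeg (∀' φ)     = ex (nnfNeg φ)

  -- Ground literals over the universe A: polarity (true = positive),
  -- relation symbol, tuple of elements. ¬¬R(a) = R(a) via polarity flip.
  record Lit (A : Set) : Set where
    constructor mkLit
    field
      pos  : Bool
      sym  : Fin (nRel V)
      args : Vec A (arity V sym)

  negLit : ∀ {A} → Lit A → Lit A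
  negLit (mkLit p R as) = mkLit (not p) R as

  module Semantics {c ℓ} (K : CommutativeSemiring c ℓ) where
    open CommutativeSemiring K using (Carrier; _+_; _*_; 0#; 1#)

    sumFin : ∀ n → (Fin n → Carrier) → Carrier
    sumFin zero    f = 0#
    sumFin (suc n) f = f zero + sumFin n (λ i → f (suc i))

    prodFin : ∀ n → (Fin n → Carrier) → Carrier
    prodFin zero    f = 1#
    prodFin (suc n) f = f zero * prodFin n (λ i → f (suc i))

    extend : ∀ {A : Set} {k} → (Fin k → A) → A → Fin (suc k) → A
    extend ν a zero    = a
    extend ν a (suc i) = ν i

    evalNNF : ∀ {n k} → (Lit (Fin n) → Carrier) → NNF k → (Fin k → Fin n) → Carrier
    evalNNF π (lit p R xs) ν = π (mkLit p R (map ν xs))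
    evalNNF π (eq x y) ν with ν x ≟ ν y
    ... | yes _ = 1#
    ... | no  _ = 0#
    evalNNF π (neq x y) ν with ν x ≟ ν y
    ... | yes _ = 0#
    ... | no  _ = 1#
    evalNNF π (and φ ψ) ν = evalNNF π φ ν * evalNNF π ψ ν
    evalNNF π (or φ ψ)  ν = evalNNF π φ ν + evalNNF π ψ ν
    evalNNF {n} π (ex φ)  ν = sumFin n (λ a → evalNNF π φ (extend ν a))
    evalNNF {n} π (all φ) ν = prodFin n (λ a → evalNNF π φ (extend ν a))

    eval : ∀ {n k} → (Lit (Fin n) → Carrier) → Formula k → (Fin k → Fin n) → Carrier
    eval π φ = evalNNF π (nnf φ)

    noVal : ∀ {n} → Fin 0 → Fin n
    noVal ()

    evalS : ∀ {n} → (Lit (Fin n) → Carrier) → Sentence → Carrier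
    evalS π φ = eval π φ noVal

module Submission where

-- Call a pair (a , b) of semiring elements *complementary* when
-- a ≉ 0 or b ≉ 0.  In a positive semiring a sum is non-zero as soon as one
-- summand is, and a product is non-zero as soon as both factors are.  Hence
-- complementary pairs are closed under the "De Morgan" combination
--   (a , a') , (b , b')  ↦  (a * b , a' + b')     (and its dual),
-- and, by iterating the dual over Fin n, a family of complementary pairs
-- (f i , g i) yields the complementary pair (Σ f , Π g).  Since nnf and
-- nnfNeg turn ∧/∨ and ∃/∀ into exactly these dual combinations, a
-- structural induction on formulas shows that (⟦nnf φ⟧ν , ⟦nnfNeg φ⟧ν) is
-- complementary for every formula φ and valuation ν, given that this holds
-- for literals.

open import Defs
open import Data.Nat using (ℕ; suc; zero)
open import Data.Fin using (Fin; _≟_)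
open import Data.Sum using (_⊎_; inj₁; inj₂)
import Data.Sum as Sum
open import Data.Product using (proj₁; proj₂)
open import Relation.Nullary using (¬_; yes; no)
open import Algebra.Bundles using (CommutativeSemiring)

module PositiveSemiring {c ℓ} (K : CommutativeSemiring c ℓ) (P : IsPositive K) where
  open CommutativeSemiring K
  open IsPositive P

  Complementary : Carrier → Carrier → Set ℓ
  Complementary a b = ¬ (a ≈ 0#) ⊎ ¬ (b ≈ 0#)

  -- Complementarity is symmetric; this realises the duality nnf ↔ nnfNeg.
  complementary-swap : ∀ {a b} → Complementary a b → Complementary b a
  complementary-swap = Sum.swap

  -- 0 ≠ 1 reversed: pairs with a component 1 (e.g. truth values of x = y) are complementary.
  1≉0 : ¬ (1# ≈ 0#)
  1≉0 e = zero≉one (sym e)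

  +-nonzeroˡ : ∀ {a} b → ¬ (a ≈ 0#) → ¬ (a + b ≈ 0#)
  +-nonzeroˡ b a≉0 e = a≉0 (proj₁ (plus-positive _ b e))

  +-nonzeroʳ : ∀ a {b} → ¬ (b ≈ 0#) → ¬ (a + b ≈ 0#)
  +-nonzeroʳ a b≉0 e = b≉0 (proj₂ (plus-positive a _ e))

  complementary-+* : ∀ {a a' b b'} → Complementary a a' → Complementary b b' →
                     Complementary (a + b) (a' * b')
  complementary-+* (inj₁ a≉0)  _            = inj₁ (+-nonzeroˡ _ a≉0)
  complementary-+* (inj₂ _)    (inj₁ b≉0)   = inj₁ (+-nonzeroʳ _ b≉0)
  complementary-+* (inj₂ a'≉0) (inj₂ b'≉0)  = inj₂ (no-zero-div _ _ a'≉0 b'≉0)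

  complementary-*+ : ∀ {a a' b b'} → Complementary a a' → Complementary b b' →
                     Complementary (a * b) (a' + b')
  complementary-*+ p q =
    complementary-swap (complementary-+* (complementary-swap p) (complementary-swap q))

  module _ (V : Vocabulary) where
    open Semantics V K

    complementary-ΣΠ : ∀ n (f g : Fin n → Carrier) →
                       (∀ i → Complementary (f i) (g i)) →
                       Complementary (sumFin n f) (prodFin n g)
    complementary-ΣΠ zero    f g fg = inj₂ 1≉0
    complementary-ΣΠ (suc n) f g fg =
      complementary-+* (fg Fin.zero)
        (complementary-ΣΠ n (λ i → f (Fin.suc i)) (λ i → g (Fin.suc i)) (λ i → fg (Fin.suc i)))

    complementary-formula :
      ∀ {n k} (π : Lit V (Fin n) → Carrier) →
      (∀ L → Complementary (π L) (π (negLit V L))) →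
      (φ : Formula V k) (ν : Fin k → Fin n) →
      Complementary (evalNNF π (nnf V φ) ν) (evalNNF π (nnfNeg V φ) ν)
    complementary-formula π lits (rel R xs) ν = lits _
    complementary-formula π lits (eq x y) ν with ν x ≟ ν y
    ... | yes _ = inj₁ 1≉0
    ... | no  _ = inj₂ 1≉0
    complementary-formula π lits (¬' φ) ν =
      complementary-swap (complementary-formula π lits φ ν)
    complementary-formula π lits (φ ∧' ψ) ν =
      complementary-*+ (complementary-formula π lits φ ν) (complementary-formula π lits ψ ν)
    complementary-formula π lits (φ ∨' ψ) ν =
      complementary-+* (complementary-formula π lits φ ν) (complementary-formula π lits ψ ν)
    complementary-formula {n} π lits (∃' φ) ν =
      complementary-ΣΠ n _ _ (λ a → complementary-formula π lits φ (extend ν a))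
    complementary-formula {n} π lits (∀' φ) ν =
      complementary-swap
        (complementary-ΣΠ n _ _ (λ a →
          complementary-swap (complementary-formula π lits φ (extend ν a))))

proposition9 : ∀ {c ℓ} (K : CommutativeSemiring c ℓ) → IsPositive K →
    (V : Vocabulary) (m : ℕ) →
    let open CommutativeSemiring K
        open Semantics V K
    in (π : Lit V (Fin (suc m)) → Carrier) →
       (∀ L → ¬ (π L ≈ 0#) ⊎ ¬ (π (negLit V L) ≈ 0#)) →
       (φ : Sentence V) →
       ¬ (evalS π φ ≈ 0#) ⊎ ¬ (evalS π (¬' φ) ≈ 0#)
proposition9 K P V m π lits φ =
  PositiveSemiring.complementary-formula K P V π lits φ (Semantics.noVal V K)
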